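{- Let $(X,Y)$ be a candidate in a red-blue edge-colored complete graph. Then $$\sum_{v\in X} d\big(X,N_R(v)\cap Y\big)\,\big|N_R(v)\cap Y\big|\ \ge\ e_R(X,Y)\,d(X,Y).$$
   Context: Consider a complete graph whose edges are colored red and blue. A candidate is a pair $(X,Y)$ of non-empty disjoint subsets of its vertex set. $e_R(A,B)$ denotes the number of red edges with one end in $A$ and the other in $B$, and for non-empty $A,B$ the density is $d(A,B)=\frac{e_R(A,B)}{|A||B|}$ (so $d(X,Y')|Y'|=e_R(X,Y')/|X|$, and a summand with $N_R(v)\cap Y=\emptyset$ is interpreted as $0$). $N_R(v)$ denotes the set of vertices $u$ such that the edge $uv$ is red. -}

module Defs where

open import Data.Bool using (Bool; true; false; if_then_else_)
open import Data.Nat as ℕ using (ℕ; zero; suc)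
open import Data.Integer using (+_)
open import Data.Fin using (Fin)
open import Data.Fin.Properties using (_≟_)
open import Data.Fin.Subset using (Subset; _∈_; _∩_; ∣_∣)
open import Data.Fin.Subset.Properties using (_∈?_)
open import Data.List using (List; map; foldr)
open import Data.Nat.ListAction using (sum)
open import Data.Product using (∃)
open import Data.List.Base using (allFin)
open import Data.Rational as ℚ using (ℚ; 0ℚ; _/_)
open import Data.Vec using (tabulate)
open import Relation.Nullary using (Dec; yes; no; ¬_)
open import Relation.Binary.PropositionalEquality using (_≡_)

data Colour : Set where
  red blue : Colour

-- A red/blue colouring of the complete graph on vertex set Fin n:
-- a colour for every pair of vertices, symmetric (the diagonal is ignored).
record Colouring (n : ℕ) : Set where
  field
    col : Fin n → Fin n → Colour
    sym : ∀ u v → col u v ≡ col v u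
open Colouring public

isRed : Colour → Bool
isRed red = true
isRed blue = false

redEdge : ∀ {n} → Colouring n → Fin n → Fin n → Bool
redEdge c u v with u ≟ v
... | yes _ = false
... | no _ = isRed (col c u v)

NR : ∀ {n} → Colouring n → Fin n → Subset n
NR c v = tabulate (λ u → redEdge c v u)

memb : ∀ {n} → Fin n → Subset n → Bool
memb x A with x ∈? A
... | yes _ = true
... | no _ = false

Σv : ∀ {n} → (Fin n → ℕ) → ℕ
Σv {n} f = sum (map f (allFin n))

Σvℚ : ∀ {n} → (Fin n → ℚ) → ℚ
Σvℚ {n} f = foldr ℚ._+_ 0ℚ (map f (allFin n))

-- e_R(A,B): number of pairs (a,b) with a ∈ A, b ∈ B, ab red
-- (for disjoint A, B this is the number of red edges between A and B).
eR : ∀ {n} → Colouring n → Subset n → Subset n → ℕ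
eR c A B = Σv (λ a → Σv (λ b →
  if memb a A then (if memb b B then (if redEdge c a b then 1 else 0) else 0) else 0))

-- m / k as a rational, with the convention m / 0 = 0
_÷_ : ℕ → ℕ → ℚ
m ÷ zero = 0ℚ
m ÷ suc k = + m / suc k

-- density d(A,B) = e_R(A,B) / (|A| |B|)  (0 if A or B is empty)
dens : ∀ {n} → Colouring n → Subset n → Subset n → ℚ
dens c A B = eR c A B ÷ (∣ A ∣ ℕ.* ∣ B ∣)

ℕ→ℚ : ℕ → ℚ
ℕ→ℚ m = + m / 1

card : ∀ {n} → Subset n → ℚ
card A = ℕ→ℚ ∣ A ∣

record IsCandidate {n : ℕ} (X Y : Subset n) : Set where
  field
    X-nonempty : ∃ λ x → x ∈ X
    Y-nonempty : ∃ λ y → y ∈ Y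
    disjoint   : ∀ v → v ∈ X → ¬ (v ∈ Y)

-- q if v ∈ A, else 0  (to restrict a sum to v ∈ A)
membℚ : ∀ {n} → Fin n → Subset n → ℚ → ℚ
membℚ v A q = if memb v A then q else 0ℚ

{-# OPTIONS --safe #-}
module Submission where

-- Let deg(b) be the number of red edges from b into X. Double counting gives e_R(X,B) = Σ_{b∈B} deg(b)
-- and Σ_{v∈X} e_R(X, N_R(v) ∩ Y) = Σ_{b∈Y} deg(b)², while d(X,B)|B||X| = e_R(X,B). Multiplied by |X||Y|,
-- the inequality therefore becomes (Σ_{b∈Y} deg(b))² ≤ |Y| Σ_{b∈Y} deg(b)², which is Cauchy–Schwarz.
-- All counting is done in ℕ and transported to ℚ along the embedding ℕ→ℚ.

open import Defs hiding (sym)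

open import Algebra.Bundles using (Ring)
open import Data.Bool using (Bool; true; false; _∧_; if_then_else_)
import Data.Bool.Properties as Bool
open import Data.Fin using (Fin)
open import Data.Fin.Subset using (Subset; _∩_; ∣_∣; Nonempty)
open import Data.Fin.Subset.Properties using (_∈?_)
open import Data.List as List using (allFin)
import Data.List.Properties as List
open import Data.Nat as ℕ using (ℕ; zero; suc)
import Data.Nat.Properties as ℕ
open import Data.Nat.Tactic.RingSolver using (solve-∀)
open import Data.Product using (_,_)
open import Data.Rational as ℚ using (ℚ; 0ℚ; toℚᵘ; fromℚᵘ)
import Data.Rational.Properties as ℚ
open import Data.Rational.Unnormalised as ℚᵘ using (ℚᵘ; mkℚᵘ)
import Data.Rational.Unnormalised.Properties as ℚᵘ
open import Data.Sum using (inj₁; inj₂)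
open import Data.Vec using ([]; _∷_; lookup; there)
import Data.Vec.Properties as Vec
import Data.Vec.Functional as Vector
open import Function using (id; _∘_; case_of_)
open import Relation.Binary.PropositionalEquality
open import Relation.Nullary using (yes; no)

open import Algebra.Properties.Semiring.Sum ℕ.+-*-semiring
import Algebra.Properties.Semiring.Sum (Ring.semiring ℚ.+-*-ring) as ℚ∑

module _ {a} {A : Set a} (_∙_ : A → A → A) (ε : A) where

  foldr-map-allFin : ∀ {n} (f : Fin n → A) →
    List.foldr _∙_ ε (List.map f (allFin n)) ≡ Vector.foldr _∙_ ε f
  foldr-map-allFin {zero} f = refl
  foldr-map-allFin {suc n} f = cong (f Fin.zero ∙_) (begin
    List.foldr _∙_ ε (List.map f (List.tabulate Fin.suc)) ≡⟨ cong (List.foldr _∙_ ε) (List.map-tabulate Fin.suc f) ⟩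
    List.foldr _∙_ ε (List.tabulate (f ∘ Fin.suc))        ≡⟨ cong (List.foldr _∙_ ε) (List.map-tabulate id (f ∘ Fin.suc)) ⟨
    List.foldr _∙_ ε (List.map (f ∘ Fin.suc) (allFin n))  ≡⟨ foldr-map-allFin (f ∘ Fin.suc) ⟩
    Vector.foldr _∙_ ε (f ∘ Fin.suc)                      ∎)
    where open ≡-Reasoning

module _ where

  open import Data.Nat using (_+_; _*_; _≤_)

  Σv≡∑ : ∀ {n} (f : Fin n → ℕ) → Σv f ≡ ∑[ i < n ] f i
  Σv≡∑ = foldr-map-allFin _+_ 0

  ∑-mono-≤ : ∀ {n} {f g : Fin n → ℕ} → (∀ i → f i ≤ g i) → ∑[ i < n ] f i ≤ ∑[ i < n ] g i
  ∑-mono-≤ {zero} f≤g = ℕ.z≤n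
  ∑-mono-≤ {suc n} f≤g = ℕ.+-mono-≤ (f≤g Fin.zero) (∑-mono-≤ (f≤g ∘ Fin.suc))

  ∑-*-∑ : ∀ {m n} (f : Fin m → ℕ) (g : Fin n → ℕ) →
    (∑[ i < m ] f i) * (∑[ j < n ] g j) ≡ ∑[ i < m ] ∑[ j < n ] (f i * g j)
  ∑-*-∑ f g = trans (*-distribʳ-sum (sum g) f) (sum-cong-≗ (λ i → *-distribˡ-sum (f i) g))

  ∑∑-distrib-+ : ∀ {m n} (f g : Fin m → Fin n → ℕ) →
    ∑[ i < m ] ∑[ j < n ] (f i j + g i j) ≡ ∑[ i < m ] ∑[ j < n ] f i j + ∑[ i < m ] ∑[ j < n ] g i j
  ∑∑-distrib-+ f g = trans (sum-cong-≗ (λ i → ∑-distrib-+ (f i) (g i))) (∑-distrib-+ (λ i → sum (f i)) (λ i → sum (g i)))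

  2*[m*n]≤m*m+n*n : ∀ m n → 2 * (m * n) ≤ m * m + n * n
  2*[m*n]≤m*m+n*n m n = case ℕ.≤-total m n of λ where
      (inj₁ m≤n) → ordered m≤n
      (inj₂ n≤m) → subst₂ _≤_ (cong (2 *_) (ℕ.*-comm n m)) (ℕ.+-comm (n * n) (m * m)) (ordered n≤m)
    where
    gap-identity : ∀ a k → a * a + (a + k) * (a + k) ≡ 2 * (a * (a + k)) + k * k
    gap-identity = solve-∀

    ordered : ∀ {a b} → a ≤ b → 2 * (a * b) ≤ a * a + b * b
    ordered {a} a≤b with k , refl ← ℕ.m≤n⇒∃[o]m+o≡n a≤b =
      subst (2 * (a * (a + k)) ≤_) (sym (gap-identity a k)) (ℕ.m≤m+n _ (k * k))

  -- Sum 2 h_i h_j ≤ h_i² + h_j², weighted by g_i g_j, over all pairs (i, j).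
  cauchy-schwarz : ∀ {n} (g h : Fin n → ℕ) →
    (∑[ i < n ] (g i * h i)) * (∑[ i < n ] (g i * h i))
      ≤ (∑[ i < n ] g i) * (∑[ i < n ] (g i * (h i * h i)))
  cauchy-schwarz {n} g h = ℕ.*-cancelˡ-≤ 2 (begin
    2 * (E * E)                                       ≡⟨ double (E * E) ⟩
    E * E + E * E                                     ≡⟨ cong₂ _+_ (∑-*-∑ gh gh) (∑-*-∑ gh gh) ⟩
    ∑[ i < n ] ∑[ j < n ] (gh i * gh j) + ∑[ i < n ] ∑[ j < n ] (gh i * gh j)
      ≡⟨ ∑∑-distrib-+ (λ i j → gh i * gh j) (λ i j → gh i * gh j) ⟨
    ∑[ i < n ] ∑[ j < n ] (gh i * gh j + gh i * gh j) ≤⟨ ∑-mono-≤ (λ i → ∑-mono-≤ (λ j → pairwise i j)) ⟩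
    ∑[ i < n ] ∑[ j < n ] (g i * ghh j + ghh i * g j) ≡⟨ ∑∑-distrib-+ (λ i j → g i * ghh j) (λ i j → ghh i * g j) ⟩
    ∑[ i < n ] ∑[ j < n ] (g i * ghh j) + ∑[ i < n ] ∑[ j < n ] (ghh i * g j)
      ≡⟨ cong₂ _+_ (∑-*-∑ g ghh) (∑-*-∑ ghh g) ⟨
    G * Q + Q * G                                     ≡⟨ cong (G * Q +_) (ℕ.*-comm Q G) ⟩
    G * Q + G * Q                                     ≡⟨ double (G * Q) ⟨
    2 * (G * Q)                                       ∎)
    where
    open ℕ.≤-Reasoning
    gh ghh : Fin n → ℕ
    gh i = g i * h i
    ghh i = g i * (h i * h i)
    E G Q : ℕ
    E = ∑[ i < n ] gh i
    G = ∑[ i < n ] g i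
    Q = ∑[ i < n ] ghh i

    double : ∀ m → 2 * m ≡ m + m
    double m = cong (m +_) (ℕ.+-identityʳ m)

    lhs-identity : ∀ a b c d → a * b * (c * d) + a * b * (c * d) ≡ a * c * (2 * (b * d))
    lhs-identity = solve-∀

    rhs-identity : ∀ a b c d → a * (c * (d * d)) + a * (b * b) * c ≡ a * c * (b * b + d * d)
    rhs-identity = solve-∀

    pairwise : ∀ i j → gh i * gh j + gh i * gh j ≤ g i * ghh j + ghh i * g j
    pairwise i j = begin
      gh i * gh j + gh i * gh j           ≡⟨ lhs-identity (g i) (h i) (g j) (h j) ⟩
      g i * g j * (2 * (h i * h j))       ≤⟨ ℕ.*-monoʳ-≤ (g i * g j) (2*[m*n]≤m*m+n*n (h i) (h j)) ⟩
      g i * g j * (h i * h i + h j * h j) ≡⟨ rhs-identity (g i) (h i) (g j) (h j) ⟨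
      g i * ghh j + ghh i * g j           ∎

  𝟙 : Bool → ℕ
  𝟙 b = if b then 1 else 0

  𝟙-∧ : ∀ a b → 𝟙 (a ∧ b) ≡ 𝟙 a * 𝟙 b
  𝟙-∧ true true = refl
  𝟙-∧ true false = refl
  𝟙-∧ false b = refl

  m*𝟙≤m : ∀ m b → m * 𝟙 b ≤ m
  m*𝟙≤m m true = ℕ.≤-reflexive (ℕ.*-identityʳ m)
  m*𝟙≤m m false = ℕ.≤-trans (ℕ.≤-reflexive (ℕ.*-zeroʳ m)) ℕ.z≤n

  memb≡lookup : ∀ {n} (x : Fin n) (p : Subset n) → memb x p ≡ lookup p x
  memb≡lookup x p with x ∈? p
  ... | yes x∈p = sym (Vec.[]=⇒lookup x∈p)
  ... | no x∉p = sym (Bool.¬-not (x∉p ∘ Vec.lookup⇒[]= x p))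

  ∣p∣≡∑𝟙 : ∀ {n} (p : Subset n) → ∣ p ∣ ≡ ∑[ i < n ] 𝟙 (lookup p i)
  ∣p∣≡∑𝟙 [] = refl
  ∣p∣≡∑𝟙 (true ∷ p) = cong suc (∣p∣≡∑𝟙 p)
  ∣p∣≡∑𝟙 (false ∷ p) = ∣p∣≡∑𝟙 p

  nonempty⇒∣p∣≢0 : ∀ {n} {p : Subset n} → Nonempty p → ℕ.NonZero ∣ p ∣
  nonempty⇒∣p∣≢0 {p = true ∷ p} _ = _
  nonempty⇒∣p∣≢0 {p = false ∷ p} (Fin.suc x , there x∈p) = nonempty⇒∣p∣≢0 (x , x∈p)

  module _ {n} (c : Colouring n) where

    redDeg : Subset n → Fin n → ℕ
    redDeg A b = ∑[ a < n ] (𝟙 (lookup A a) * 𝟙 (redEdge c a b))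

    redDeg≤∣A∣ : ∀ A b → redDeg A b ≤ ∣ A ∣
    redDeg≤∣A∣ A b = ℕ.≤-trans (∑-mono-≤ (λ a → m*𝟙≤m (𝟙 (lookup A a)) (redEdge c a b))) (ℕ.≤-reflexive (sym (∣p∣≡∑𝟙 A)))

    eR≡∑redDeg : ∀ A B → eR c A B ≡ ∑[ b < n ] (𝟙 (lookup B b) * redDeg A b)
    eR≡∑redDeg A B = begin
      eR c A B
        ≡⟨ trans (Σv≡∑ (λ a → Σv (pair a))) (sum-cong-≗ (λ a → trans (Σv≡∑ (pair a)) (sum-cong-≗ (indicators a)))) ⟩
      ∑[ a < n ] ∑[ b < n ] (𝟙 (lookup B b) * (𝟙 (lookup A a) * 𝟙 (redEdge c a b)))
        ≡⟨ ∑-comm (λ a b → 𝟙 (lookup B b) * (𝟙 (lookup A a) * 𝟙 (redEdge c a b))) ⟩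
      ∑[ b < n ] ∑[ a < n ] (𝟙 (lookup B b) * (𝟙 (lookup A a) * 𝟙 (redEdge c a b)))
        ≡⟨ sum-cong-≗ (λ b → *-distribˡ-sum (𝟙 (lookup B b)) (λ a → 𝟙 (lookup A a) * 𝟙 (redEdge c a b))) ⟨
      ∑[ b < n ] (𝟙 (lookup B b) * redDeg A b) ∎
      where
      open ≡-Reasoning
      nested-if : ∀ p q r → (if p then (if q then (if r then 1 else 0) else 0) else 0) ≡ 𝟙 q * (𝟙 p * 𝟙 r)
      nested-if true true true = refl
      nested-if true true false = refl
      nested-if true false r = refl
      nested-if false q r = sym (ℕ.*-zeroʳ (𝟙 q))

      pair : Fin n → Fin n → ℕ
      pair a b = if memb a A then (if memb b B then (if redEdge c a b then 1 else 0) else 0) else 0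

      indicators : ∀ a b → pair a b ≡ 𝟙 (lookup B b) * (𝟙 (lookup A a) * 𝟙 (redEdge c a b))
      indicators a b rewrite memb≡lookup a A | memb≡lookup b B = nested-if (lookup A a) (lookup B b) (redEdge c a b)

    eR≤∣A∣*∣B∣ : ∀ A B → eR c A B ≤ ∣ A ∣ * ∣ B ∣
    eR≤∣A∣*∣B∣ A B = begin
      eR c A B                                 ≡⟨ eR≡∑redDeg A B ⟩
      ∑[ b < n ] (𝟙 (lookup B b) * redDeg A b) ≤⟨ ∑-mono-≤ (λ b → ℕ.*-monoʳ-≤ (𝟙 (lookup B b)) (redDeg≤∣A∣ A b)) ⟩
      ∑[ b < n ] (𝟙 (lookup B b) * ∣ A ∣)      ≡⟨ *-distribʳ-sum ∣ A ∣ (𝟙 ∘ lookup B) ⟨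
      (∑[ b < n ] 𝟙 (lookup B b)) * ∣ A ∣      ≡⟨ cong (_* ∣ A ∣) (∣p∣≡∑𝟙 B) ⟨
      ∣ B ∣ * ∣ A ∣                            ≡⟨ ℕ.*-comm ∣ B ∣ ∣ A ∣ ⟩
      ∣ A ∣ * ∣ B ∣                            ∎
      where open ℕ.≤-Reasoning

    double-counting : ∀ A (w : Fin n → ℕ) →
      ∑[ v < n ] (𝟙 (lookup A v) * ∑[ b < n ] (𝟙 (redEdge c v b) * w b)) ≡ ∑[ b < n ] (redDeg A b * w b)
    double-counting A w = begin
      ∑[ v < n ] (𝟙 (lookup A v) * ∑[ b < n ] (𝟙 (redEdge c v b) * w b))
        ≡⟨ sum-cong-≗ (λ v → *-distribˡ-sum (𝟙 (lookup A v)) (λ b → 𝟙 (redEdge c v b) * w b)) ⟩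
      ∑[ v < n ] ∑[ b < n ] (𝟙 (lookup A v) * (𝟙 (redEdge c v b) * w b))
        ≡⟨ ∑-comm (λ v b → 𝟙 (lookup A v) * (𝟙 (redEdge c v b) * w b)) ⟩
      ∑[ b < n ] ∑[ v < n ] (𝟙 (lookup A v) * (𝟙 (redEdge c v b) * w b))
        ≡⟨ sum-cong-≗ (λ b → sum-cong-≗ (λ v → ℕ.*-assoc (𝟙 (lookup A v)) (𝟙 (redEdge c v b)) (w b))) ⟨
      ∑[ b < n ] ∑[ v < n ] (𝟙 (lookup A v) * 𝟙 (redEdge c v b) * w b)
        ≡⟨ sum-cong-≗ (λ b → *-distribʳ-sum (w b) (λ v → 𝟙 (lookup A v) * 𝟙 (redEdge c v b))) ⟨
      ∑[ b < n ] (redDeg A b * w b) ∎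
      where open ≡-Reasoning

    ∑eR[X,NR∩Y]≡∑redDeg² : ∀ X Y →
      ∑[ v < n ] (𝟙 (lookup X v) * eR c X (NR c v ∩ Y)) ≡ ∑[ b < n ] (𝟙 (lookup Y b) * (redDeg X b * redDeg X b))
    ∑eR[X,NR∩Y]≡∑redDeg² X Y = begin
      ∑[ v < n ] (𝟙 (lookup X v) * eR c X (NR c v ∩ Y))
        ≡⟨ sum-cong-≗ (λ v → cong (𝟙 (lookup X v) *_) (trans (eR≡∑redDeg X (NR c v ∩ Y)) (sum-cong-≗ (split v)))) ⟩
      ∑[ v < n ] (𝟙 (lookup X v) * ∑[ b < n ] (𝟙 (redEdge c v b) * (𝟙 (lookup Y b) * redDeg X b)))
        ≡⟨ double-counting X (λ b → 𝟙 (lookup Y b) * redDeg X b) ⟩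
      ∑[ b < n ] (redDeg X b * (𝟙 (lookup Y b) * redDeg X b))
        ≡⟨ sum-cong-≗ (λ b → swap (redDeg X b) (𝟙 (lookup Y b))) ⟩
      ∑[ b < n ] (𝟙 (lookup Y b) * (redDeg X b * redDeg X b)) ∎
      where
      open ≡-Reasoning
      split : ∀ v b → 𝟙 (lookup (NR c v ∩ Y) b) * redDeg X b ≡ 𝟙 (redEdge c v b) * (𝟙 (lookup Y b) * redDeg X b)
      split v b = begin
        𝟙 (lookup (NR c v ∩ Y) b) * redDeg X b
          ≡⟨ cong (λ s → 𝟙 s * redDeg X b) (Vec.lookup-zipWith _∧_ b (NR c v) Y) ⟩
        𝟙 (lookup (NR c v) b ∧ lookup Y b) * redDeg X b
          ≡⟨ cong (λ s → 𝟙 (s ∧ lookup Y b) * redDeg X b) (Vec.lookup∘tabulate (redEdge c v) b) ⟩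
        𝟙 (redEdge c v b ∧ lookup Y b) * redDeg X b
          ≡⟨ cong (_* redDeg X b) (𝟙-∧ (redEdge c v b) (lookup Y b)) ⟩
        𝟙 (redEdge c v b) * 𝟙 (lookup Y b) * redDeg X b
          ≡⟨ ℕ.*-assoc (𝟙 (redEdge c v b)) (𝟙 (lookup Y b)) (redDeg X b) ⟩
        𝟙 (redEdge c v b) * (𝟙 (lookup Y b) * redDeg X b) ∎

      swap : ∀ d y → d * (y * d) ≡ y * (d * d)
      swap = solve-∀

    eR²≤∣Y∣*∑eR[X,NR∩Y] : ∀ X Y →
      eR c X Y * eR c X Y ≤ ∣ Y ∣ * ∑[ v < n ] (𝟙 (lookup X v) * eR c X (NR c v ∩ Y))
    eR²≤∣Y∣*∑eR[X,NR∩Y] X Y = begin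
      eR c X Y * eR c X Y
        ≡⟨ cong₂ _*_ (eR≡∑redDeg X Y) (eR≡∑redDeg X Y) ⟩
      (∑[ b < n ] (𝟙 (lookup Y b) * redDeg X b)) * (∑[ b < n ] (𝟙 (lookup Y b) * redDeg X b))
        ≤⟨ cauchy-schwarz (𝟙 ∘ lookup Y) (redDeg X) ⟩
      (∑[ b < n ] 𝟙 (lookup Y b)) * ∑[ b < n ] (𝟙 (lookup Y b) * (redDeg X b * redDeg X b))
        ≡⟨ cong₂ _*_ (∣p∣≡∑𝟙 Y) (∑eR[X,NR∩Y]≡∑redDeg² X Y) ⟨
      ∣ Y ∣ * ∑[ v < n ] (𝟙 (lookup X v) * eR c X (NR c v ∩ Y)) ∎
      where open ℕ.≤-Reasoning

open import Data.Integer as ℤ using (+_)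
import Data.Integer.Properties as ℤ
open import Data.Rational using (_≤_; _*_)

fromℚᵘ-homo-+ : ∀ p q → fromℚᵘ (p ℚᵘ.+ q) ≡ fromℚᵘ p ℚ.+ fromℚᵘ q
fromℚᵘ-homo-+ p q = begin
  fromℚᵘ (p ℚᵘ.+ q)                             ≡⟨ ℚ.fromℚᵘ-cong (ℚᵘ.+-cong (ℚ.toℚᵘ-fromℚᵘ p) (ℚ.toℚᵘ-fromℚᵘ q)) ⟨
  fromℚᵘ (toℚᵘ (fromℚᵘ p) ℚᵘ.+ toℚᵘ (fromℚᵘ q)) ≡⟨ ℚ.fromℚᵘ-cong (ℚ.toℚᵘ-homo-+ (fromℚᵘ p) (fromℚᵘ q)) ⟨
  fromℚᵘ (toℚᵘ (fromℚᵘ p ℚ.+ fromℚᵘ q))         ≡⟨ ℚ.fromℚᵘ-toℚᵘ (fromℚᵘ p ℚ.+ fromℚᵘ q) ⟩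
  fromℚᵘ p ℚ.+ fromℚᵘ q                         ∎
  where open ≡-Reasoning

fromℚᵘ-homo-* : ∀ p q → fromℚᵘ (p ℚᵘ.* q) ≡ fromℚᵘ p * fromℚᵘ q
fromℚᵘ-homo-* p q = begin
  fromℚᵘ (p ℚᵘ.* q)                             ≡⟨ ℚ.fromℚᵘ-cong (ℚᵘ.*-cong (ℚ.toℚᵘ-fromℚᵘ p) (ℚ.toℚᵘ-fromℚᵘ q)) ⟨
  fromℚᵘ (toℚᵘ (fromℚᵘ p) ℚᵘ.* toℚᵘ (fromℚᵘ q)) ≡⟨ ℚ.fromℚᵘ-cong (ℚ.toℚᵘ-homo-* (fromℚᵘ p) (fromℚᵘ q)) ⟨
  fromℚᵘ (toℚᵘ (fromℚᵘ p * fromℚᵘ q))           ≡⟨ ℚ.fromℚᵘ-toℚᵘ (fromℚᵘ p * fromℚᵘ q) ⟩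
  fromℚᵘ p * fromℚᵘ q                           ∎
  where open ≡-Reasoning

fromℚᵘ-mono-≤ : ∀ {p q} → p ℚᵘ.≤ q → fromℚᵘ p ≤ fromℚᵘ q
fromℚᵘ-mono-≤ {p} {q} p≤q = ℚ.toℚᵘ-cancel-≤
  (ℚᵘ.≤-respˡ-≃ (ℚᵘ.≃-sym (ℚ.toℚᵘ-fromℚᵘ p)) (ℚᵘ.≤-respʳ-≃ (ℚᵘ.≃-sym (ℚ.toℚᵘ-fromℚᵘ q)) p≤q))

-- ℕ→ℚ m reduces to fromℚᵘ (ℕ→ℚᵘ m), so ℕ→ℚ inherits the arithmetic of ℕ→ℚᵘ.
ℕ→ℚᵘ : ℕ → ℚᵘ
ℕ→ℚᵘ m = mkℚᵘ (+ m) 0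

ℕ→ℚ-+ : ∀ m n → ℕ→ℚ (m ℕ.+ n) ≡ ℕ→ℚ m ℚ.+ ℕ→ℚ n
ℕ→ℚ-+ m n = trans (cong (λ k → fromℚᵘ (mkℚᵘ k 0)) numerators) (fromℚᵘ-homo-+ (ℕ→ℚᵘ m) (ℕ→ℚᵘ n))
  where
  numerators : + (m ℕ.+ n) ≡ + m ℤ.* + 1 ℤ.+ + n ℤ.* + 1
  numerators = trans (ℤ.pos-+ m n) (sym (cong₂ ℤ._+_ (ℤ.*-identityʳ (+ m)) (ℤ.*-identityʳ (+ n))))

ℕ→ℚ-* : ∀ m n → ℕ→ℚ (m ℕ.* n) ≡ ℕ→ℚ m * ℕ→ℚ n
ℕ→ℚ-* m n = trans (cong (λ k → fromℚᵘ (mkℚᵘ k 0)) (ℤ.pos-* m n)) (fromℚᵘ-homo-* (ℕ→ℚᵘ m) (ℕ→ℚᵘ n))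

ℕ→ℚ-mono-≤ : ∀ {m n} → m ℕ.≤ n → ℕ→ℚ m ≤ ℕ→ℚ n
ℕ→ℚ-mono-≤ {m} {n} m≤n = fromℚᵘ-mono-≤ {ℕ→ℚᵘ m} {ℕ→ℚᵘ n} (ℚᵘ.*≤* (ℤ.*-monoʳ-≤-nonNeg (+ 1) (ℤ.+≤+ m≤n)))

ℕ→ℚ-pos : ∀ n .{{_ : ℕ.NonZero n}} → ℚ.Positive (ℕ→ℚ n)
ℕ→ℚ-pos n = ℚ.normalize-pos n 1

ℕ→ℚ-∑ : ∀ {n} (f : Fin n → ℕ) → ℕ→ℚ (∑[ i < n ] f i) ≡ ℚ∑.sum (ℕ→ℚ ∘ f)
ℕ→ℚ-∑ {zero} f = refl
ℕ→ℚ-∑ {suc n} f = trans (ℕ→ℚ-+ (f Fin.zero) _) (cong (ℕ→ℚ (f Fin.zero) ℚ.+_) (ℕ→ℚ-∑ (f ∘ Fin.suc)))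

m÷n*n≡m : ∀ {m n} → (n ≡ 0 → m ≡ 0) → (m ÷ n) * ℕ→ℚ n ≡ ℕ→ℚ m
m÷n*n≡m {m} {zero} n≡0⇒m≡0 rewrite n≡0⇒m≡0 refl = ℚ.*-zeroˡ 0ℚ
m÷n*n≡m {m} {suc k} _ = trans (sym (fromℚᵘ-homo-* (mkℚᵘ (+ m) k) (ℕ→ℚᵘ (suc k))))
  (ℚ.fromℚᵘ-cong {mkℚᵘ (+ m) k ℚᵘ.* ℕ→ℚᵘ (suc k)} {ℕ→ℚᵘ m} (ℚᵘ.*≡* (ℤ.*-assoc (+ m) (+ suc k) (+ 1))))

Σvℚ≡∑ : ∀ {n} (f : Fin n → ℚ) → Σvℚ f ≡ ℚ∑.sum f
Σvℚ≡∑ = foldr-map-allFin ℚ._+_ 0ℚ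

membℚ≡𝟙* : ∀ {n} (v : Fin n) A q → membℚ v A q ≡ ℕ→ℚ (𝟙 (lookup A v)) * q
membℚ≡𝟙* v A q = trans (if-then-0 (memb v A)) (cong (λ b → ℕ→ℚ (𝟙 b) * q) (memb≡lookup v A))
  where
  if-then-0 : ∀ b → (if b then q else 0ℚ) ≡ ℕ→ℚ (𝟙 b) * q
  if-then-0 true = sym (ℚ.*-identityˡ q)
  if-then-0 false = sym (ℚ.*-zeroˡ q)

module _ {n} (c : Colouring n) where

  dens*∣A∣∣B∣≡eR : ∀ A B → dens c A B * ℕ→ℚ (∣ A ∣ ℕ.* ∣ B ∣) ≡ ℕ→ℚ (eR c A B)
  dens*∣A∣∣B∣≡eR A B = m÷n*n≡m (λ ∣A∣∣B∣≡0 → ℕ.n≤0⇒n≡0 (subst (eR c A B ℕ.≤_) ∣A∣∣B∣≡0 (eR≤∣A∣*∣B∣ c A B)))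

  dens*card*∣A∣≡eR : ∀ A B → dens c A B * card B * ℕ→ℚ ∣ A ∣ ≡ ℕ→ℚ (eR c A B)
  dens*card*∣A∣≡eR A B = begin
    dens c A B * card B * ℕ→ℚ ∣ A ∣    ≡⟨ ℚ.*-assoc (dens c A B) (card B) (ℕ→ℚ ∣ A ∣) ⟩
    dens c A B * (card B * ℕ→ℚ ∣ A ∣)  ≡⟨ cong (dens c A B *_) (ℚ.*-comm (card B) (ℕ→ℚ ∣ A ∣)) ⟩
    dens c A B * (ℕ→ℚ ∣ A ∣ * card B)  ≡⟨ cong (dens c A B *_) (ℕ→ℚ-* ∣ A ∣ ∣ B ∣) ⟨
    dens c A B * ℕ→ℚ (∣ A ∣ ℕ.* ∣ B ∣) ≡⟨ dens*∣A∣∣B∣≡eR A B ⟩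
    ℕ→ℚ (eR c A B)                     ∎
    where open ≡-Reasoning

  ∑dens*card*∣X∣≡∑eR : ∀ X Y →
    Σvℚ (λ v → membℚ v X (dens c X (NR c v ∩ Y) * card (NR c v ∩ Y))) * ℕ→ℚ ∣ X ∣
      ≡ ℕ→ℚ (∑[ v < n ] (𝟙 (lookup X v) ℕ.* eR c X (NR c v ∩ Y)))
  ∑dens*card*∣X∣≡∑eR X Y = begin
    Σvℚ term * ℕ→ℚ ∣ X ∣              ≡⟨ cong (_* ℕ→ℚ ∣ X ∣) (Σvℚ≡∑ term) ⟩
    ℚ∑.sum term * ℕ→ℚ ∣ X ∣           ≡⟨ ℚ∑.*-distribʳ-sum (ℕ→ℚ ∣ X ∣) term ⟩
    ℚ∑.sum (λ v → term v * ℕ→ℚ ∣ X ∣) ≡⟨ ℚ∑.sum-cong-≗ term*∣X∣ ⟩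
    ℚ∑.sum (λ v → ℕ→ℚ (𝟙 (lookup X v) ℕ.* eR c X (NR c v ∩ Y)))
                                             ≡⟨ ℕ→ℚ-∑ (λ v → 𝟙 (lookup X v) ℕ.* eR c X (NR c v ∩ Y)) ⟨
    ℕ→ℚ (∑[ v < n ] (𝟙 (lookup X v) ℕ.* eR c X (NR c v ∩ Y))) ∎
    where
    open ≡-Reasoning
    term : Fin n → ℚ
    term v = membℚ v X (dens c X (NR c v ∩ Y) * card (NR c v ∩ Y))

    term*∣X∣ : ∀ v → term v * ℕ→ℚ ∣ X ∣ ≡ ℕ→ℚ (𝟙 (lookup X v) ℕ.* eR c X (NR c v ∩ Y))
    term*∣X∣ v = begin
      term v * ℕ→ℚ ∣ X ∣                               ≡⟨ cong (_* ℕ→ℚ ∣ X ∣) (membℚ≡𝟙* v X q) ⟩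
      ℕ→ℚ (𝟙 (lookup X v)) * q * ℕ→ℚ ∣ X ∣             ≡⟨ ℚ.*-assoc (ℕ→ℚ (𝟙 (lookup X v))) q (ℕ→ℚ ∣ X ∣) ⟩
      ℕ→ℚ (𝟙 (lookup X v)) * (q * ℕ→ℚ ∣ X ∣)           ≡⟨ cong (ℕ→ℚ (𝟙 (lookup X v)) *_) (dens*card*∣A∣≡eR X (NR c v ∩ Y)) ⟩
      ℕ→ℚ (𝟙 (lookup X v)) * ℕ→ℚ (eR c X (NR c v ∩ Y)) ≡⟨ ℕ→ℚ-* (𝟙 (lookup X v)) (eR c X (NR c v ∩ Y)) ⟨
      ℕ→ℚ (𝟙 (lookup X v) ℕ.* eR c X (NR c v ∩ Y)) ∎
      where q = dens c X (NR c v ∩ Y) * card (NR c v ∩ Y)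

lemma3p1 : {n : ℕ} (c : Colouring n) (X Y : Subset n) → IsCandidate X Y →
    ℕ→ℚ (eR c X Y) * dens c X Y
      ≤ Σvℚ (λ v → membℚ v X (dens c X (NR c v ∩ Y) * card (NR c v ∩ Y)))
lemma3p1 {n} c X Y candidate = ℚ.*-cancelʳ-≤-pos (ℕ→ℚ (∣ X ∣ ℕ.* ∣ Y ∣)) {{ℕ→ℚ-pos _ {{∣X∣∣Y∣≢0}}}} (begin
  ℕ→ℚ e * dens c X Y * ℕ→ℚ (∣ X ∣ ℕ.* ∣ Y ∣)   ≡⟨ ℚ.*-assoc (ℕ→ℚ e) (dens c X Y) _ ⟩
  ℕ→ℚ e * (dens c X Y * ℕ→ℚ (∣ X ∣ ℕ.* ∣ Y ∣)) ≡⟨ cong (ℕ→ℚ e *_) (dens*∣A∣∣B∣≡eR c X Y) ⟩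
  ℕ→ℚ e * ℕ→ℚ e                                ≡⟨ ℕ→ℚ-* e e ⟨
  ℕ→ℚ (e ℕ.* e)                                ≤⟨ ℕ→ℚ-mono-≤ (eR²≤∣Y∣*∑eR[X,NR∩Y] c X Y) ⟩
  ℕ→ℚ (∣ Y ∣ ℕ.* S)                            ≡⟨ trans (cong ℕ→ℚ (ℕ.*-comm ∣ Y ∣ S)) (ℕ→ℚ-* S ∣ Y ∣) ⟩
  ℕ→ℚ S * ℕ→ℚ ∣ Y ∣                            ≡⟨ cong (_* ℕ→ℚ ∣ Y ∣) (∑dens*card*∣X∣≡∑eR c X Y) ⟨
  R * ℕ→ℚ ∣ X ∣ * ℕ→ℚ ∣ Y ∣                    ≡⟨ ℚ.*-assoc R (ℕ→ℚ ∣ X ∣) (ℕ→ℚ ∣ Y ∣) ⟩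
  R * (ℕ→ℚ ∣ X ∣ * ℕ→ℚ ∣ Y ∣)                  ≡⟨ cong (R *_) (ℕ→ℚ-* ∣ X ∣ ∣ Y ∣) ⟨
  R * ℕ→ℚ (∣ X ∣ ℕ.* ∣ Y ∣)                    ∎)
  where
  open ℚ.≤-Reasoning
  open IsCandidate candidate using (X-nonempty; Y-nonempty)
  e S : ℕ
  e = eR c X Y
  S = ∑[ v < n ] (𝟙 (lookup X v) ℕ.* eR c X (NR c v ∩ Y))
  R : ℚ
  R = Σvℚ (λ v → membℚ v X (dens c X (NR c v ∩ Y) * card (NR c v ∩ Y)))
  ∣X∣∣Y∣≢0 : ℕ.NonZero (∣ X ∣ ℕ.* ∣ Y ∣)
  ∣X∣∣Y∣≢0 = ℕ.m*n≢0 ∣ X ∣ ∣ Y ∣ {{nonempty⇒∣p∣≢0 X-nonempty}} {{nonempty⇒∣p∣≢0 Y-nonempty}}
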